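{- Let $d$ be a positive integer with $d\equiv 6$, $8$ or $0 \pmod{10}$. Then the equation $x+y-z=d$ admits no EGZ-generalization, i.e. $R(x+y-z=d,2)\neq R(x+y-z=d,\mathbb{Z}/3\mathbb{Z})$.
   Context: $[1,n]=\{1,\dots,n\}$. For an equation $\mathcal{L}$ in three variables and a coloring $\chi:[1,n]\to\{0,\dots,r-1\}$, a solution $(x_1,x_2,x_3)\in[1,n]^3$ is monochromatic if all $\chi(x_i)$ are equal, and zero-sum (for $r=3$) if $\chi(x_1)+\chi(x_2)+\chi(x_3)\equiv0\pmod 3$. $R(\mathcal{L},2)$ is the least $N$ (if it exists) such that for all $n\ge N$ every $2$-coloring of $[1,n]$ has a monochromatic solution of $\mathcal{L}$; $R(\mathcal{L},\mathbb{Z}/3\mathbb{Z})$ is the least $N$ (if it exists) such that for all $n\ge N$ every map $[1,n]\to\{0,1,2\}$ has a zero-sum solution of $\mathcal{L}$. $\mathcal{L}$ admits an EGZ-generalization if $R(\mathcal{L},2)=R(\mathcal{L},\mathbb{Z}/3\mathbb{Z})$. -}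

module Defs where

open import Data.Nat using (ℕ; _≤_; _<_; _%_)
open import Data.Fin using (Fin; toℕ)
open import Data.Integer using (ℤ; +_; _+_; _-_)
open import Data.Product using (_×_; ∃)
open import Relation.Binary.PropositionalEquality using (_≡_)
open import Relation.Nullary using (¬_)
open import Function.Bundles using (_⇔_)

Equation : Set₁
Equation = ℕ → ℕ → ℕ → Set

linEq : ℕ → Equation
linEq d x y z = (+ x) + (+ y) - (+ z) ≡ + d

InRange : ℕ → ℕ → Set
InRange n x = 1 ≤ x × x ≤ n

Solution : Equation → ℕ → ℕ → ℕ → ℕ → Set
Solution L n x y z = InRange n x × InRange n y × InRange n z × L x y z

-- Colorings of [1,n] with r colors (values outside [1,n] are irrelevant).
Coloring : ℕ → Set
Coloring r = ℕ → Fin r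

MonoProp : Equation → ℕ → Set
MonoProp L n = (χ : Coloring 2) → ∃ λ x → ∃ λ y → ∃ λ z →
  Solution L n x y z × χ x ≡ χ y × χ y ≡ χ z

ZeroSumProp : Equation → ℕ → Set
ZeroSumProp L n = (χ : Coloring 3) → ∃ λ x → ∃ λ y → ∃ λ z →
  Solution L n x y z × (toℕ (χ x) Data.Nat.+ toℕ (χ y) Data.Nat.+ toℕ (χ z)) % 3 ≡ 0

IsLeastThreshold : (ℕ → Set) → ℕ → Set
IsLeastThreshold P N = (∀ n → N ≤ n → P n) × (∀ M → M < N → ¬ (∀ n → M ≤ n → P n))

IsR2 : Equation → ℕ → Set
IsR2 L = IsLeastThreshold (MonoProp L)

IsRZ3 : Equation → ℕ → Set
IsRZ3 L = IsLeastThreshold (ZeroSumProp L)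

-- L admits an EGZ-generalization: R(L,2) = R(L,ℤ/3ℤ), as an equality of
-- possibly-undefined values (for every N, R(L,2) = N iff R(L,ℤ/3ℤ) = N).
AdmitsEGZ : Equation → Set
AdmitsEGZ L = ∀ N → IsR2 L N ⇔ IsRZ3 L N

-- Write d = 10k + 6 + 2j with j ≤ 2 and M = 8k + 5 + 2j; we show R(L,2) ≤ M < R(L,ℤ/3ℤ).
-- Upper bound: ten points of [1,M] carry solutions (a,a,b), (b,b,c), (c,a,d), (e,h,d) and, for
-- x ∈ {e,h}, a wing (x,a,f), (g,a,x), (b,g,f).  If b avoids the colour of a, then c takes it, d
-- avoids it, and e or h takes it; that point's wing then contains a monochromatic solution.
-- Lower bound: colour odd numbers 0 and an even number 2u by 2 if s < u < t and by 1 otherwise.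
-- Parity forces a zero-sum solution of x + y = d + z to be all even with its halves in one
-- band, and u + v = d/2 + w (u, v ≤ (M-1)/2) has no solution inside one band once
-- s = k + 1 and t = 3k + 3 + ⌊j/2⌋, a choice that works only for j ≤ 2.
module Submission where

open import Defs
open import Data.Nat using (ℕ; _%_; _≤_)
open import Data.Sum using (_⊎_)
open import Relation.Binary.PropositionalEquality using (_≡_)
open import Relation.Nullary using (¬_)

open import Data.Bool using (T)
open import Data.Empty using (⊥-elim)
open import Data.Fin using (Fin; zero; suc; toℕ)
open import Data.Fin.Properties using () renaming (_≟_ to _≟ᶠ_)
import Data.Integer as ℤ
import Data.Integer.Properties as ℤ
open import Algebra.Properties.AbelianGroup ℤ.+-0-abelianGroup using (//-rightDividesˡ; quasigroup)
open import Algebra.Properties.Quasigroup quasigroup using (x≈z//y)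
open import Data.List using (_∷_; [])
open import Data.Nat using (zero; suc; _+_; _*_; _/_; _<_; _≤ᵇ_; _≡ᵇ_; z≤n; s≤s; parity; ⌊_/2⌋)
open import Data.Nat.DivMod using (m≡m%n+[m/n]*n)
open import Data.Nat.Properties
open import Data.Nat.Tactic.RingSolver using (solve)
open import Data.Parity.Base as ℙ using (Parity; 0ℙ; 1ℙ)
open import Data.Parity.Properties using (+-homo-+; p+p≡0ℙ)
open import Data.Product using (_×_; ∃; _,_; proj₁)
open import Data.Sum using (inj₁; inj₂)
open import Function.Base using (_∘_)
open import Function.Bundles using (_⇔_; mk⇔; Equivalence)
open import Relation.Binary.PropositionalEquality
  using (_≢_; refl; sym; trans; cong; cong₂; subst; module ≡-Reasoning)
open import Relation.Nullary using (yes; no)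

linEq⇔ : ∀ d x y z → linEq d x y z ⇔ (x + y ≡ d + z)
linEq⇔ d x y z = mk⇔
  (λ eq → ℤ.+-injective
    (trans (sym (//-rightDividesˡ (ℤ.+ z) (ℤ.+ (x + y)))) (cong (ℤ._+ ℤ.+ z) eq)))
  (λ eq → sym (x≈z//y (ℤ.+ d) (ℤ.+ z) (ℤ.+ (x + y)) (cong ℤ.+_ (sym eq))))

Solution-mono : ∀ {L m n x y z} → m ≤ n → Solution L m x y z → Solution L n x y z
Solution-mono m≤n ((x₁ , x≤m) , (y₁ , y≤m) , (z₁ , z≤m) , eq) =
  (x₁ , ≤-trans x≤m m≤n) , (y₁ , ≤-trans y≤m m≤n) , (z₁ , ≤-trans z≤m m≤n) , eq

MonoProp-mono : ∀ {L m n} → m ≤ n → MonoProp L m → MonoProp L n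
MonoProp-mono {L} m≤n mono χ with mono χ
... | x , y , z , sol , χx≡χy , χy≡χz = x , y , z , Solution-mono {L} m≤n sol , χx≡χy , χy≡χz

-- The least threshold exists only classically; under ¬ ¬ that is enough, as the goal is negative.
¬¬least-threshold : (P : ℕ → Set) (M : ℕ) → (∀ n → M ≤ n → P n) →
                    ¬ ¬ ∃ λ N → N ≤ M × IsLeastThreshold P N
¬¬least-threshold P zero    from-0 ¬least = ¬least (0 , z≤n , from-0 , λ _ ())
¬¬least-threshold P (suc M) from-1+M ¬least =
  not-not-from-M (λ from-M → ¬¬least-threshold P M from-M (λ (N , N≤M , least) →
    ¬least (N , m≤n⇒m≤1+n N≤M , least)))
  where
    not-not-from-M : ¬ ¬ (∀ n → M ≤ n → P n)
    not-not-from-M ¬from-M = ¬least (suc M , ≤-refl , from-1+M , λ M′ M′<1+M from-M′ →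
      ¬from-M (λ n M≤n → from-M′ n (≤-trans (≤-pred M′<1+M) M≤n)))

¬EGZ-if-separated : ∀ {L} M → MonoProp L M → ¬ ZeroSumProp L M → ¬ AdmitsEGZ L
¬EGZ-if-separated {L} M mono ¬zero-sum egz =
  ¬¬least-threshold (MonoProp L) M (λ n M≤n → MonoProp-mono {L} M≤n mono)
    (λ (N , N≤M , R₂≡N) → ¬zero-sum (proj₁ (Equivalence.to (egz N) R₂≡N) M N≤M))

MonochromaticSolution : (ℕ → ℕ → ℕ → Set) → Coloring 2 → Set
MonochromaticSolution S χ = ∃ λ x → ∃ λ y → ∃ λ z → S x y z × χ x ≡ χ y × χ y ≡ χ z

record Wing (S : ℕ → ℕ → ℕ → Set) (a b e : ℕ) : Set where
  constructor wing
  field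
    f g : ℕ
    eaf : S e a f
    gae : S g a e
    bgf : S b g f

record Gadget (S : ℕ → ℕ → ℕ → Set) : Set where
  constructor gadget
  field
    a b c d e h : ℕ
    aab : S a a b
    bbc : S b b c
    cad : S c a d
    ehd : S e h d
    wing-e : Wing S a b e
    wing-h : Wing S a b h

two-colours : {u v w : Fin 2} → u ≢ w → v ≢ w → u ≡ v
two-colours {zero}     {zero}                 _   _   = refl
two-colours {suc zero} {suc zero}             _   _   = refl
two-colours {zero}     {suc zero} {zero}      u≢w _   = ⊥-elim (u≢w refl)
two-colours {zero}     {suc zero} {suc zero}  _   v≢w = ⊥-elim (v≢w refl)
two-colours {suc zero} {zero}     {zero}      _   v≢w = ⊥-elim (v≢w refl)
two-colours {suc zero} {zero}     {suc zero}  u≢w _   = ⊥-elim (u≢w refl)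

module _ {S : ℕ → ℕ → ℕ → Set} (χ : Coloring 2) where

  private
    mono : ∀ {x y z} → S x y z → χ x ≡ χ y → χ y ≡ χ z → MonochromaticSolution S χ
    mono sol χx≡χy χy≡χz = _ , _ , _ , sol , χx≡χy , χy≡χz

  wing-monochromatic : ∀ {a b e} → Wing S a b e → χ b ≢ χ a → χ e ≡ χ a →
                       MonochromaticSolution S χ
  wing-monochromatic {a} (wing f g eaf gae bgf) b≢a e≡a with χ f ≟ᶠ χ a | χ g ≟ᶠ χ a
  ... | yes f≡a | _       = mono eaf e≡a (sym f≡a)
  ... | no _    | yes g≡a = mono gae g≡a (sym e≡a)
  ... | no f≢a  | no g≢a  = mono bgf (two-colours b≢a g≢a) (two-colours g≢a f≢a)

  gadget-monochromatic : Gadget S → MonochromaticSolution S χ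
  gadget-monochromatic (gadget a b c d e h aab bbc cad ehd wing-e wing-h) with χ b ≟ᶠ χ a
  ... | yes b≡a = mono aab refl (sym b≡a)
  ... | no b≢a with χ c ≟ᶠ χ a
  ...   | no c≢a = mono bbc refl (two-colours b≢a c≢a)
  ...   | yes c≡a with χ d ≟ᶠ χ a
  ...     | yes d≡a = mono cad c≡a (sym d≡a)
  ...     | no d≢a with χ e ≟ᶠ χ a | χ h ≟ᶠ χ a
  ...       | yes e≡a | _       = wing-monochromatic wing-e b≢a e≡a
  ...       | no _    | yes h≡a = wing-monochromatic wing-h b≢a h≡a
  ...       | no e≢a  | no h≢a  = mono ehd (two-colours e≢a h≢a) (two-colours h≢a d≢a)

linear-gadget : ∀ k m → Gadget (Solution (linEq (10 * k + (6 + m))) (8 * k + (5 + m)))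
linear-gadget k m = record
  { a = P 8 5 ; b = P 6 4 ; c = P 2 2 ; d = P 0 1 ; e = P 5 3 ; h = P 5 4
  ; aab = solution 8 5 8 5 6 4
  ; bbc = solution 6 4 6 4 2 2
  ; cad = solution 2 2 8 5 0 1
  ; ehd = solution 5 3 5 4 0 1
  ; wing-e = record { f = P 3 2 ; g = P 7 4
                    ; eaf = solution 5 3 8 5 3 2 ; gae = solution 7 4 8 5 5 3 ; bgf = solution 6 4 7 4 3 2 }
  ; wing-h = record { f = P 3 3 ; g = P 7 5
                    ; eaf = solution 5 4 8 5 3 3 ; gae = solution 7 5 8 5 5 4 ; bgf = solution 6 4 7 5 3 3 }
  }
  where
    P : ℕ → ℕ → ℕ
    P a b = a * k + (b + m)

    Admissible : ℕ → ℕ → Set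
    Admissible a b = T (a ≤ᵇ 8) × T (1 ≤ᵇ b) × T (b ≤ᵇ 5)

    P-in-range : ∀ a b → Admissible a b → InRange (8 * k + (5 + m)) (P a b)
    P-in-range a b (a≤8 , 1≤b , b≤5) =
      ≤-trans (≤ᵇ⇒≤ 1 b 1≤b) (≤-trans (m≤m+n b m) (m≤n+m (b + m) (a * k))) ,
      +-mono-≤ (*-monoˡ-≤ k (≤ᵇ⇒≤ a 8 a≤8)) (+-monoˡ-≤ m (≤ᵇ⇒≤ b 5 b≤5))

    P-equation : ∀ a₁ b₁ a₂ b₂ a₃ b₃ → a₁ + a₂ ≡ 10 + a₃ → b₁ + b₂ ≡ 6 + b₃ →
                 P a₁ b₁ + P a₂ b₂ ≡ (10 * k + (6 + m)) + P a₃ b₃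
    P-equation a₁ b₁ a₂ b₂ a₃ b₃ ≡a ≡b = begin
      (a₁ * k + (b₁ + m)) + (a₂ * k + (b₂ + m)) ≡⟨ solve (a₁ ∷ b₁ ∷ a₂ ∷ b₂ ∷ k ∷ m ∷ []) ⟩
      (a₁ + a₂) * k + ((b₁ + b₂) + (m + m))     ≡⟨ cong₂ (λ u v → u * k + (v + (m + m))) ≡a ≡b ⟩
      (10 + a₃) * k + ((6 + b₃) + (m + m))      ≡⟨ solve (a₃ ∷ b₃ ∷ k ∷ m ∷ []) ⟩
      (10 * k + (6 + m)) + (a₃ * k + (b₃ + m))  ∎
      where open ≡-Reasoning

    -- The side conditions are closed booleans, discharged by evaluation.
    solution : ∀ a₁ b₁ a₂ b₂ a₃ b₃ →
               {T (a₁ + a₂ ≡ᵇ 10 + a₃)} → {T (b₁ + b₂ ≡ᵇ 6 + b₃)} →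
               {Admissible a₁ b₁} → {Admissible a₂ b₂} → {Admissible a₃ b₃} →
               Solution (linEq (10 * k + (6 + m))) (8 * k + (5 + m)) (P a₁ b₁) (P a₂ b₂) (P a₃ b₃)
    solution a₁ b₁ a₂ b₂ a₃ b₃ {≡a} {≡b} {r₁} {r₂} {r₃} =
      P-in-range a₁ b₁ r₁ , P-in-range a₂ b₂ r₂ , P-in-range a₃ b₃ r₃ ,
      Equivalence.from (linEq⇔ (10 * k + (6 + m)) (P a₁ b₁) (P a₂ b₂) (P a₃ b₃))
        (P-equation a₁ b₁ a₂ b₂ a₃ b₃ (≡ᵇ⇒≡ _ _ ≡a) (≡ᵇ⇒≡ _ _ ≡b))

linear-mono : ∀ k m → MonoProp (linEq (10 * k + (6 + m))) (8 * k + (5 + m))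
linear-mono k m χ = gadget-monochromatic χ (linear-gadget k m)

⊎-colour : {A B : Set} → A ⊎ B → Fin 3
⊎-colour (inj₁ _) = suc (suc zero)
⊎-colour (inj₂ _) = suc zero

⊎-colour-zero-sum : {A₁ B₁ A₂ B₂ A₃ B₃ : Set} (u : A₁ ⊎ B₁) (v : A₂ ⊎ B₂) (w : A₃ ⊎ B₃) →
                    (toℕ (⊎-colour u) + toℕ (⊎-colour v) + toℕ (⊎-colour w)) % 3 ≡ 0 →
                    (A₁ × A₂ × A₃) ⊎ (B₁ × B₂ × B₃)
⊎-colour-zero-sum (inj₁ a₁) (inj₁ a₂) (inj₁ a₃) _ = inj₁ (a₁ , a₂ , a₃)
⊎-colour-zero-sum (inj₂ b₁) (inj₂ b₂) (inj₂ b₃) _ = inj₂ (b₁ , b₂ , b₃)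
⊎-colour-zero-sum (inj₁ _)  (inj₁ _)  (inj₂ _)  ()
⊎-colour-zero-sum (inj₁ _)  (inj₂ _)  (inj₁ _)  ()
⊎-colour-zero-sum (inj₁ _)  (inj₂ _)  (inj₂ _)  ()
⊎-colour-zero-sum (inj₂ _)  (inj₁ _)  (inj₁ _)  ()
⊎-colour-zero-sum (inj₂ _)  (inj₁ _)  (inj₂ _)  ()
⊎-colour-zero-sum (inj₂ _)  (inj₂ _)  (inj₁ _)  ()

parity-of-sum : ∀ e x y z → x + y ≡ (e + e) + z → parity x ℙ.+ parity y ≡ parity z
parity-of-sum e x y z eq = begin
  parity x ℙ.+ parity y        ≡⟨ +-homo-+ x y ⟨
  parity (x + y)               ≡⟨ cong parity eq ⟩
  parity ((e + e) + z)         ≡⟨ +-homo-+ (e + e) z ⟩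
  parity (e + e) ℙ.+ parity z  ≡⟨ cong (ℙ._+ parity z) (trans (+-homo-+ e e) (p+p≡0ℙ (parity e))) ⟩
  parity z                     ∎
  where open ≡-Reasoning

⌊n/2⌋+⌊n/2⌋≡n : ∀ n → parity n ≡ 0ℙ → ⌊ n /2⌋ + ⌊ n /2⌋ ≡ n
⌊n/2⌋+⌊n/2⌋≡n zero          _    = refl
⌊n/2⌋+⌊n/2⌋≡n (suc (suc n)) even =
  cong suc (trans (+-suc ⌊ n /2⌋ ⌊ n /2⌋) (cong suc (⌊n/2⌋+⌊n/2⌋≡n n even)))

a+a≤1+L+L⇒a≤L : ∀ {a L} → a + a ≤ suc (L + L) → a ≤ L
a+a≤1+L+L⇒a≤L {a} {L} a+a≤1+L+L = ≮⇒≥ λ L<a → 1+n≰n (begin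
  suc (suc (L + L))  ≡⟨ cong suc (+-suc L L) ⟨
  suc L + suc L      ≤⟨ +-mono-≤ L<a L<a ⟩
  a + a              ≤⟨ a+a≤1+L+L ⟩
  suc (L + L)        ∎)
  where open ≤-Reasoning

1≤a+a⇒1≤a : ∀ {a} → 1 ≤ a + a → 1 ≤ a
1≤a+a⇒1≤a {suc _} _ = s≤s z≤n

halve-equation : ∀ a b e c → (a + a) + (b + b) ≡ (e + e) + (c + c) → a + b ≡ e + c
halve-equation a b e c eq = begin
  a + b                        ≡⟨ n≡⌊n+n/2⌋ (a + b) ⟩
  ⌊ (a + b) + (a + b) /2⌋      ≡⟨ cong ⌊_/2⌋ (begin
      (a + b) + (a + b)        ≡⟨ solve (a ∷ b ∷ []) ⟩
      (a + a) + (b + b)        ≡⟨ eq ⟩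
      (e + e) + (c + c)        ≡⟨ solve (e ∷ c ∷ []) ⟩
      (e + c) + (e + c)        ∎) ⟩
  ⌊ (e + c) + (e + c) /2⌋      ≡⟨ n≡⌊n+n/2⌋ (e + c) ⟨
  e + c                        ∎
  where open ≡-Reasoning

module _ (s t : ℕ) where

  Inner Outer : ℕ → Set
  Inner a = s < a × a < t
  Outer a = a ≤ s ⊎ t ≤ a

  band : ∀ a → Inner a ⊎ Outer a
  band a with a ≤? s | t ≤? a
  ... | yes a≤s | _       = inj₂ (inj₁ a≤s)
  ... | no _    | yes t≤a = inj₂ (inj₂ t≤a)
  ... | no a≰s  | no t≰a  = inj₁ (≰⇒> a≰s , ≰⇒> t≰a)

  bandColour : Parity → ℕ → Fin 3
  bandColour 1ℙ _ = zero
  bandColour 0ℙ a = ⊎-colour (band a)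

  bandColouring : Coloring 3
  bandColouring n = bandColour (parity n) ⌊ n /2⌋

  bandColour-zero-sum :
    ∀ p q r a b c → p ℙ.+ q ≡ r →
    (toℕ (bandColour p a) + toℕ (bandColour q b) + toℕ (bandColour r c)) % 3 ≡ 0 →
    p ≡ 0ℙ × q ≡ 0ℙ × r ≡ 0ℙ × ((Inner a × Inner b × Inner c) ⊎ (Outer a × Outer b × Outer c))
  bandColour-zero-sum 0ℙ 0ℙ 0ℙ a b c _ sum≡0 =
    refl , refl , refl , ⊎-colour-zero-sum (band a) (band b) (band c) sum≡0
  bandColour-zero-sum 1ℙ 1ℙ 0ℙ _ _ c _ sum≡0 with band c | sum≡0
  ... | inj₁ _ | ()
  ... | inj₂ _ | ()
  bandColour-zero-sum 1ℙ 0ℙ 1ℙ _ b _ _ sum≡0 with band b | sum≡0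
  ... | inj₁ _ | ()
  ... | inj₂ _ | ()
  bandColour-zero-sum 0ℙ 1ℙ 1ℙ a _ _ _ sum≡0 with band a | sum≡0
  ... | inj₁ _ | ()
  ... | inj₂ _ | ()
  bandColour-zero-sum 0ℙ 0ℙ 1ℙ _ _ _ ()
  bandColour-zero-sum 0ℙ 1ℙ 0ℙ _ _ _ ()
  bandColour-zero-sum 1ℙ 0ℙ 0ℙ _ _ _ ()
  bandColour-zero-sum 1ℙ 1ℙ 1ℙ _ _ _ ()

module _ {e L s t : ℕ} (L+s≤e : L + s ≤ e) (e+s<t+t : e + s < t + t)
         (L+L<e+t : L + L < e + t) (t+t≤2+e+s : t + t ≤ 2 + (e + s)) where

  open ≤-Reasoning

  inner-no-solution : ∀ {a b c} → Inner s t a → Inner s t b → Inner s t c → a + b ≢ e + c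
  inner-no-solution {a} {b} {c} (_ , a<t) (_ , b<t) (s<c , _) a+b≡e+c = <-irrefl refl (begin-strict
    e + s  <⟨ +-monoʳ-< e s<c ⟩
    e + c  ≡⟨ a+b≡e+c ⟨
    a + b  ≤⟨ +-cancelˡ-≤ 2 (a + b) (e + s) (begin
      2 + (a + b)    ≡⟨ cong suc (+-suc a b) ⟨
      suc a + suc b  ≤⟨ +-mono-≤ a<t b<t ⟩
      t + t          ≤⟨ t+t≤2+e+s ⟩
      2 + (e + s)    ∎) ⟩
    e + s  ∎)

  outer-no-solution : ∀ {a b c} → a ≤ L → b ≤ L → 1 ≤ c →
                      Outer s t a → Outer s t b → Outer s t c → a + b ≢ e + c
  outer-no-solution {a} {b} {c} _ b≤L 1≤c (inj₁ a≤s) _ _ a+b≡e+c = <-irrefl refl (begin-strict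
    e      <⟨ m<m+n e 1≤c ⟩
    e + c  ≡⟨ a+b≡e+c ⟨
    a + b  ≤⟨ +-mono-≤ a≤s b≤L ⟩
    s + L  ≡⟨ +-comm s L ⟩
    L + s  ≤⟨ L+s≤e ⟩
    e      ∎)
  outer-no-solution {a} {b} {c} a≤L _ 1≤c (inj₂ _) (inj₁ b≤s) _ a+b≡e+c = <-irrefl refl (begin-strict
    e      <⟨ m<m+n e 1≤c ⟩
    e + c  ≡⟨ a+b≡e+c ⟨
    a + b  ≤⟨ +-mono-≤ a≤L b≤s ⟩
    L + s  ≤⟨ L+s≤e ⟩
    e      ∎)
  outer-no-solution {a} {b} {c} _ _ _ (inj₂ t≤a) (inj₂ t≤b) (inj₁ c≤s) a+b≡e+c = <-irrefl refl (begin-strict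
    e + c  ≤⟨ +-monoʳ-≤ e c≤s ⟩
    e + s  <⟨ e+s<t+t ⟩
    t + t  ≤⟨ +-mono-≤ t≤a t≤b ⟩
    a + b  ≡⟨ a+b≡e+c ⟩
    e + c  ∎)
  outer-no-solution {a} {b} {c} a≤L b≤L _ (inj₂ _) (inj₂ _) (inj₂ t≤c) a+b≡e+c = <-irrefl refl (begin-strict
    e + t  ≤⟨ +-monoʳ-≤ e t≤c ⟩
    e + c  ≡⟨ a+b≡e+c ⟨
    a + b  ≤⟨ +-mono-≤ a≤L b≤L ⟩
    L + L  <⟨ L+L<e+t ⟩
    e + t  ∎)

  band-no-even-solution : ∀ {a b c} → a ≤ L → b ≤ L → 1 ≤ c →
    (Inner s t a × Inner s t b × Inner s t c) ⊎ (Outer s t a × Outer s t b × Outer s t c) →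
    a + b ≢ e + c
  band-no-even-solution _ _ _ (inj₁ (ia , ib , ic)) = inner-no-solution ia ib ic
  band-no-even-solution a≤L b≤L 1≤c (inj₂ (oa , ob , oc)) = outer-no-solution a≤L b≤L 1≤c oa ob oc

  band-no-zero-sum : ∀ {d n} → e + e ≡ d → n ≤ suc (L + L) → ¬ ZeroSumProp (linEq d) n
  band-no-zero-sum {d} {n} e+e≡d n≤1+L+L zero-sum with zero-sum (bandColouring s t)
  ... | x , y , z , ((_ , x≤n) , (_ , y≤n) , (1≤z , _) , sol) , sum≡0 =
    let x-even , y-even , z-even , classes =
          bandColour-zero-sum s t (parity x) (parity y) (parity z) ⌊ x /2⌋ ⌊ y /2⌋ ⌊ z /2⌋
            (parity-of-sum e x y z x+y≡e+e+z) sum≡0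
    in band-no-even-solution (half-≤ x x-even x≤n) (half-≤ y y-even y≤n)
         (1≤a+a⇒1≤a (subst (1 ≤_) (sym (⌊n/2⌋+⌊n/2⌋≡n z z-even)) 1≤z)) classes
         (halve-equation ⌊ x /2⌋ ⌊ y /2⌋ e ⌊ z /2⌋ (begin-equality
            ⌊ x /2⌋ + ⌊ x /2⌋ + (⌊ y /2⌋ + ⌊ y /2⌋)
              ≡⟨ cong₂ _+_ (⌊n/2⌋+⌊n/2⌋≡n x x-even) (⌊n/2⌋+⌊n/2⌋≡n y y-even) ⟩
            x + y                                    ≡⟨ x+y≡e+e+z ⟩
            (e + e) + z                              ≡⟨ cong ((e + e) +_) (⌊n/2⌋+⌊n/2⌋≡n z z-even) ⟨
            (e + e) + (⌊ z /2⌋ + ⌊ z /2⌋)            ∎))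
    where
      x+y≡e+e+z : x + y ≡ (e + e) + z
      x+y≡e+e+z = trans (Equivalence.to (linEq⇔ d x y z) sol) (cong (_+ z) (sym e+e≡d))

      half-≤ : ∀ w → parity w ≡ 0ℙ → w ≤ n → ⌊ w /2⌋ ≤ L
      half-≤ w w-even w≤n = a+a≤1+L+L⇒a≤L
        (subst (_≤ suc (L + L)) (sym (⌊n/2⌋+⌊n/2⌋≡n w w-even)) (≤-trans w≤n n≤1+L+L))

linear-no-zero-sum : ∀ k e₀ L₀ s₀ t₀ → L₀ + s₀ ≤ e₀ → e₀ + s₀ < t₀ + t₀ →
                     L₀ + L₀ < e₀ + t₀ → t₀ + t₀ ≤ 2 + (e₀ + s₀) →
                     ¬ ZeroSumProp (linEq (10 * k + (e₀ + e₀))) (8 * k + suc (L₀ + L₀))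
linear-no-zero-sum k e₀ L₀ s₀ t₀ h₁ h₂ h₃ h₄ =
  band-no-zero-sum {e = 5 * k + e₀} {L = 4 * k + L₀} {s = k + s₀} {t = 3 * k + t₀}
    (begin
      (4 * k + L₀) + (k + s₀)          ≡⟨ solve (k ∷ L₀ ∷ s₀ ∷ []) ⟩
      5 * k + (L₀ + s₀)                ≤⟨ +-monoʳ-≤ (5 * k) h₁ ⟩
      5 * k + e₀                       ∎)
    (begin-strict
      (5 * k + e₀) + (k + s₀)          ≡⟨ solve (k ∷ e₀ ∷ s₀ ∷ []) ⟩
      6 * k + (e₀ + s₀)                <⟨ +-monoʳ-< (6 * k) h₂ ⟩
      6 * k + (t₀ + t₀)                ≡⟨ solve (k ∷ t₀ ∷ []) ⟩
      (3 * k + t₀) + (3 * k + t₀)      ∎)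
    (begin-strict
      (4 * k + L₀) + (4 * k + L₀)      ≡⟨ solve (k ∷ L₀ ∷ []) ⟩
      8 * k + (L₀ + L₀)                <⟨ +-monoʳ-< (8 * k) h₃ ⟩
      8 * k + (e₀ + t₀)                ≡⟨ solve (k ∷ e₀ ∷ t₀ ∷ []) ⟩
      (5 * k + e₀) + (3 * k + t₀)      ∎)
    (begin
      (3 * k + t₀) + (3 * k + t₀)      ≡⟨ solve (k ∷ t₀ ∷ []) ⟩
      6 * k + (t₀ + t₀)                ≤⟨ +-monoʳ-≤ (6 * k) h₄ ⟩
      6 * k + (2 + (e₀ + s₀))          ≡⟨ solve (k ∷ e₀ ∷ s₀ ∷ []) ⟩
      2 + ((5 * k + e₀) + (k + s₀))    ∎)
    {d = 10 * k + (e₀ + e₀)} {n = 8 * k + suc (L₀ + L₀)}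
    (solve (k ∷ e₀ ∷ []))
    (≤-reflexive (solve (k ∷ L₀ ∷ [])))
  where open ≤-Reasoning

¬EGZ-10k+6+2j : ∀ k j → j ≤ 2 → ¬ AdmitsEGZ (linEq (10 * k + (6 + 2 * j)))
¬EGZ-10k+6+2j k 0 _ = ¬EGZ-if-separated _ (linear-mono k 0)
  (linear-no-zero-sum k 3 2 1 3 (≤ᵇ⇒≤ _ _ _) (≤ᵇ⇒≤ _ _ _) (≤ᵇ⇒≤ _ _ _) (≤ᵇ⇒≤ _ _ _))
¬EGZ-10k+6+2j k 1 _ = ¬EGZ-if-separated _ (linear-mono k 2)
  (linear-no-zero-sum k 4 3 1 3 (≤ᵇ⇒≤ _ _ _) (≤ᵇ⇒≤ _ _ _) (≤ᵇ⇒≤ _ _ _) (≤ᵇ⇒≤ _ _ _))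
¬EGZ-10k+6+2j k 2 _ = ¬EGZ-if-separated _ (linear-mono k 4)
  (linear-no-zero-sum k 5 4 1 4 (≤ᵇ⇒≤ _ _ _) (≤ᵇ⇒≤ _ _ _) (≤ᵇ⇒≤ _ _ _) (≤ᵇ⇒≤ _ _ _))
¬EGZ-10k+6+2j k (suc (suc (suc _))) (s≤s (s≤s ()))

m%10≡r⇒10*[m/10]+r≡m : ∀ d {r} → d % 10 ≡ r → 10 * (d / 10) + r ≡ d
m%10≡r⇒10*[m/10]+r≡m d {r} d%10≡r = begin
  10 * (d / 10) + r        ≡⟨ cong (10 * (d / 10) +_) d%10≡r ⟨
  10 * (d / 10) + d % 10   ≡⟨ +-comm (10 * (d / 10)) (d % 10) ⟩
  d % 10 + 10 * (d / 10)   ≡⟨ cong (d % 10 +_) (*-comm 10 (d / 10)) ⟩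
  d % 10 + (d / 10) * 10   ≡⟨ m≡m%n+[m/n]*n d 10 ⟨
  d                        ∎
  where open ≡-Reasoning

corollary4 : (d : ℕ) → 1 ≤ d → (d % 10 ≡ 6 ⊎ d % 10 ≡ 8 ⊎ d % 10 ≡ 0) →
    ¬ AdmitsEGZ (linEq d)
corollary4 d _ (inj₁ d%10≡6) =
  subst (¬_ ∘ AdmitsEGZ ∘ linEq) (m%10≡r⇒10*[m/10]+r≡m d d%10≡6) (¬EGZ-10k+6+2j (d / 10) 0 z≤n)
corollary4 d _ (inj₂ (inj₁ d%10≡8)) =
  subst (¬_ ∘ AdmitsEGZ ∘ linEq) (m%10≡r⇒10*[m/10]+r≡m d d%10≡8) (¬EGZ-10k+6+2j (d / 10) 1 (s≤s z≤n))
corollary4 d 1≤d (inj₂ (inj₂ d%10≡0)) with d / 10 | m%10≡r⇒10*[m/10]+r≡m d d%10≡0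
... | zero  | 0≡d = λ _ → <-irrefl 0≡d 1≤d
... | suc q | 10[1+q]≡d =
  subst (¬_ ∘ AdmitsEGZ ∘ linEq) (begin
    10 * q + 10     ≡⟨ solve (q ∷ []) ⟩
    10 * suc q + 0  ≡⟨ 10[1+q]≡d ⟩
    d               ∎) (¬EGZ-10k+6+2j q 2 (s≤s (s≤s z≤n)))
  where open ≡-Reasoning
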